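{- Let $Q$ be finite with rank function $\rho$ and maximal rank $m$, with types, subsumption order, models and type interpretation as in the context. For every $k\le m$, every simple type $A$, and all $S,T\subseteq\mathcal{T}^k_A$: $[\![S]\!]^k\le[\![T]\!]^k$ in $\mathcal{D}^k_A$ if and only if $S\sqsubseteq_A T$.
   Context: $Q_k=\{q:\rho(q)=k\}$, $Q_{\le k}=\{q:\rho(q)\le k\}$. Intersection types: $\tau^k_o=Q_k$, $\tau^k_{A\to B}=\{T\to s: T\subseteq\mathcal{T}^k_A, s\in\tau^k_B\}$, $\mathcal{T}^k_A=\bigcup_{l\le k}\tau^l_A$. Subsumption: least relations with $S\sqsubseteq_o T$ if $S\subseteq T\subseteq Q$; $s\sqsubseteq_o t$ if $s=t$; $S\sqsubseteq_A T$ if every $s\in S$ has $t\in T$ with $s\sqsubseteq_A t$; $S\to s\sqsubseteq_{A\to B}T\to t$ if $T\sqsubseteq_A S$ and $s\sqsubseteq_B t$. Models: $\mathcal{D}^0_o=\mathcal{P}(Q_0)$, $\mathcal{D}^0_{A\to B}$ = monotone maps; for $k>0$: $\mathcal{D}^k_o=\mathcal{P}(Q_{\le k})$, $\mathcal{L}^k_o=\{(R,P): R=P\cap Q_{\le k-1}\}$, $\mathcal{L}^k_{A\to B}=\{(f_1,f_2): f_1\in\mathcal{D}^{k-1}_{A\to B}$, $f_2$ monotone $\mathcal{D}^k_A\to\mathcal{D}^k_B$, $(f_1(g_1),f_2(g_2))\in\mathcal{L}^k_B$ whenever $(g_1,g_2)\in\mathcal{L}^k_A\}$, $\mathcal{D}^k_{A\to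 B}=\{f_2:\exists f_1,(f_1,f_2)\in\mathcal{L}^k_{A\to B}\}$; order inclusion/pointwise; $\bot^k_B$ least element. Step function: $(d\Rightarrow e)(h)=e$ if $d\le h$, else $\bot^k_B$. $[\![q]\!]^k=\{q\}$ if $\rho(q)\le k$, else $\emptyset$; $[\![S]\!]^k=\bigvee\{[\![t]\!]^k:t\in S\}$; $[\![T\to s]\!]^k=[\![T]\!]^k\Rightarrow[\![s]\!]^k$. -}

module Defs where

open import Level using (0ℓ)
open import Data.Nat using (ℕ; zero; suc; _≤_; _≤ᵇ_)
open import Data.Fin using (Fin)
open import Data.Bool using (Bool; true; false; _∧_; _∨_; if_then_else_)
open import Data.Product using (Σ; _×_)
open import Data.List using (List; []; _∷_)
open import Data.List.Relation.Unary.All using (All)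
open import Data.List.Relation.Unary.Any using (Any)
open import Data.List.Membership.Propositional using (_∈_)
open import Relation.Binary.PropositionalEquality using (_≡_)
open import Relation.Nullary using (does)
open import Axiom.ExcludedMiddle using (ExcludedMiddle)

data Ty : Set where
  o   : Ty
  _⇒_ : Ty → Ty → Ty

infixr 5 _⇒_

module Model (n : ℕ) (ρ : Fin n → ℕ) where

  Q : Set
  Q = Fin n

  -- Intersection types (raw syntax), refined by the predicates τ^k_A.
  -- A finite set of intersection types is represented by a list.

  data ITy : Ty → Set where
    atom : Q → ITy o
    _↦_  : {A B : Ty} → List (ITy A) → ITy B → ITy (A ⇒ B)

  mutual
    τ : ℕ → (A : Ty) → ITy A → Set
    τ k o (atom q) = ρ q ≡ k
    τ k (A ⇒ B) (T ↦ s) = All (𝒯 k A) T × τ k B s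

    𝒯 : ℕ → (A : Ty) → ITy A → Set
    𝒯 k A t = Σ ℕ (λ l → l ≤ k × τ l A t)

  mutual
    _⊑_ : {A : Ty} → ITy A → ITy A → Set
    _⊑_ {o} (atom p) (atom q) = p ≡ q
    _⊑_ {A ⇒ B} (S ↦ s) (T ↦ t) = (T ⊑ˢ S) × (s ⊑ t)

    _⊑ˢ_ : {A : Ty} → List (ITy A) → List (ITy A) → Set
    _⊑ˢ_ {o} S T = ∀ {x} → x ∈ S → x ∈ T
    _⊑ˢ_ {A ⇒ B} S T = All (λ s → Any (λ t → s ⊑ t) T) S

  -- Semantic models.
  -- Ambient carriers: a subset of Q is a Bool-valued predicate, and
  -- functions are Agda functions.  𝒟^k_A is carved out by InD k A.

  Sem : Ty → Set
  Sem o = Q → Bool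
  Sem (A ⇒ B) = Sem A → Sem B

  mutual
    InD : ℕ → (A : Ty) → Sem A → Set
    InD zero    o P = ∀ q → P q ≡ true → ρ q ≡ 0
    InD (suc k) o P = ∀ q → P q ≡ true → ρ q ≤ suc k
    InD zero    (A ⇒ B) f = Mono zero A B f
    InD (suc k) (A ⇒ B) f = Σ (Sem (A ⇒ B)) (λ f₁ → 𝓛 k (A ⇒ B) f₁ f)

    Mono : ℕ → (A B : Ty) → Sem (A ⇒ B) → Set
    Mono k A B f =
      (∀ h → InD k A h → InD k B (f h)) ×
      (∀ h h' → InD k A h → InD k A h' → Le k A h h' → Le k B (f h) (f h'))

    Le : ℕ → (A : Ty) → Sem A → Sem A → Set
    Le k o P P' = ∀ q → P q ≡ true → P' q ≡ true
    Le k (A ⇒ B) f g = ∀ h → InD k A h → Le k B (f h) (g h)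

    -- 𝓛 k A = the relation 𝓛^{k+1}_A  ⊆ 𝒟^k_A × 𝒟^{k+1}_A
    𝓛 : ℕ → (A : Ty) → Sem A → Sem A → Set
    𝓛 k o R P = InD (suc k) o P × (∀ q → R q ≡ (P q ∧ (ρ q ≤ᵇ k)))
    𝓛 k (A ⇒ B) f₁ f₂ =
      InD k (A ⇒ B) f₁ × Mono (suc k) A B f₂ ×
      (∀ g₁ g₂ → 𝓛 k A g₁ g₂ → 𝓛 k B (f₁ g₁) (f₂ g₂))

  bot : (A : Ty) → Sem A
  bot o = λ _ → false
  bot (A ⇒ B) = λ _ → bot B

  join : (A : Ty) → Sem A → Sem A → Sem A
  join o P P' = λ q → P q ∨ P' q
  join (A ⇒ B) f g = λ h → join B (f h) (g h)

  -- Type interpretation (classical metatheory: the step function needs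
  -- to decide d ≤ h, for which excluded middle is assumed).

  module Interp (em : ExcludedMiddle 0ℓ) where

    step : ℕ → (A B : Ty) → Sem A → Sem B → Sem (A ⇒ B)
    step k A B d e h = if does (em {Le k A d h}) then e else bot B

    mutual
      ⟦_⟧ : {A : Ty} → ITy A → ℕ → Sem A
      ⟦ atom q ⟧ k = λ p → (ρ q ≤ᵇ k) ∧ does (p Data.Fin.≟ q)
      ⟦ _↦_ {A} {B} T s ⟧ k = step k A B (⟦ T ⟧ˢ k) (⟦ s ⟧ k)

      ⟦_⟧ˢ : {A : Ty} → List (ITy A) → ℕ → Sem A
      ⟦_⟧ˢ {A} [] k = bot A
      ⟦_⟧ˢ {A} (t ∷ T) k = join A (⟦ t ⟧ k) (⟦ T ⟧ˢ k)

-- Soundness (⊑ implies ≤) holds because step functions are antitone in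
-- their argument and monotone in their value.
--
-- At o, an atom q ∈ S of rank ≤ k is
-- detected by evaluating both interpretations at q.  At A ⇒ B, apply both
-- sides to h = ⟦S'⟧ for an element S' ↦ s' of S: then ⟦s'⟧ lies below the
-- join of the codomains t' of those T' ↦ t' in T with ⟦T'⟧ ≤ h, so the
-- induction hypothesis at B yields such a t' with s' ⊑ t', and the one at A
-- turns ⟦T'⟧ ≤ ⟦S'⟧ into T' ⊑ S'.  That h is a legal argument, i.e. that
-- interpretations lie in 𝒟ᵏ, is the real work: for k > 0 it means that
-- (⟦t⟧ᵏ⁻¹, ⟦t⟧ᵏ) ∈ 𝓛ᵏ, which is proved together with the fact that the
-- order transfers between consecutive levels along 𝓛.

module Submission where

open import Defs
open import Level using (0ℓ)
open import Data.Nat using (ℕ; zero; suc; _≤_; _<_; _≤ᵇ_)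
open import Data.Nat.Properties using (≤ᵇ⇒≤; ≤⇒≤ᵇ; <⇒≱; ≰⇒>; n≤0⇒n≡0; m≤n⇒m≤1+n; ≤-trans; _≤?_)
open import Data.Fin using (Fin; _≟_)
open import Data.Bool using (true; false; _∧_; _∨_; if_then_else_)
open import Data.Bool.Properties using (T-≡; ∧-zeroʳ; ∧-distribʳ-∨)
open import Data.Empty using (⊥-elim)
open import Data.Sum using (_⊎_; inj₁; inj₂)
open import Data.Product using (∃; _×_; _,_; proj₁; proj₂)
open import Data.List using (List; []; _∷_; map; filter)
open import Data.List.Relation.Unary.All as All using (All; []; _∷_)
open import Data.List.Relation.Unary.Any as Any using (Any; here; there)
open import Data.List.Relation.Unary.Any.Properties using (map⁻)
open import Data.List.Relation.Unary.All.Properties using (map⁺; filter⁺)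
open import Data.List.Membership.Propositional using (_∈_; find; lose)
open import Data.List.Membership.Propositional.Properties using (∈-filter⁻)
open import Relation.Binary.PropositionalEquality using (_≡_; _≢_; refl; sym; trans; cong; cong₂; subst)
open import Relation.Nullary using (¬_; Dec; yes; no; does)
open import Relation.Nullary.Decidable using (dec-true)
open import Relation.Unary using (Decidable)
open import Function.Bundles using (_⇔_; mk⇔; Equivalence)
open import Axiom.ExcludedMiddle using (ExcludedMiddle)

∨≡true⇒⊎ : ∀ a b → a ∨ b ≡ true → a ≡ true ⊎ b ≡ true
∨≡true⇒⊎ true  _ _ = inj₁ refl
∨≡true⇒⊎ false _ e = inj₂ e

∧≡true⇒× : ∀ a b → a ∧ b ≡ true → a ≡ true × b ≡ true
∧≡true⇒× true true _ = refl , refl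

≤ᵇ≡true⇒≤ : ∀ m k → (m ≤ᵇ k) ≡ true → m ≤ k
≤ᵇ≡true⇒≤ m k e = ≤ᵇ⇒≤ m k (Equivalence.from T-≡ e)

≤⇒≤ᵇ≡true : ∀ {m k} → m ≤ k → (m ≤ᵇ k) ≡ true
≤⇒≤ᵇ≡true m≤k = Equivalence.to T-≡ (≤⇒≤ᵇ m≤k)

≟≡true⇒≡ : ∀ {m} (p q : Fin m) → does (p ≟ q) ≡ true → p ≡ q
≟≡true⇒≡ p q e with p ≟ q
... | yes p≡q = p≡q

module _ (n : ℕ) (ρ : Fin n → ℕ) where
  open Model n ρ

  Le-refl : ∀ k A f → Le k A f f
  Le-refl k o       f q fq = fq
  Le-refl k (A ⇒ B) f h _  = Le-refl k B (f h)

  Le-trans : ∀ k A {f g h} → Le k A f g → Le k A g h → Le k A f h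
  Le-trans k o       f≤g g≤h q fq    = g≤h q (f≤g q fq)
  Le-trans k (A ⇒ B) f≤g g≤h x x-InD = Le-trans k B (f≤g x x-InD) (g≤h x x-InD)

  join-o-elim : ∀ (X : Q → Set) f g → (∀ q → f q ≡ true → X q) → (∀ q → g q ≡ true → X q) →
                ∀ q → join o f g q ≡ true → X q
  join-o-elim X f g fX gX q e with ∨≡true⇒⊎ (f q) (g q) e
  ... | inj₁ fq = fX q fq
  ... | inj₂ gq = gX q gq

  join-upperˡ : ∀ k A f g → Le k A f (join A f g)
  join-upperˡ k o       f g q fq = cong (_∨ g q) fq
  join-upperˡ k (A ⇒ B) f g h _  = join-upperˡ k B (f h) (g h)

  join-upperʳ : ∀ k A f g → Le k A g (join A f g)
  join-upperʳ k o       f g q gq with f q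
  ... | true  = refl
  ... | false = gq
  join-upperʳ k (A ⇒ B) f g h _ = join-upperʳ k B (f h) (g h)

  join-least : ∀ k A {f g c} → Le k A f c → Le k A g c → Le k A (join A f g) c
  join-least k o       {f} {g} {c} f≤c g≤c = join-o-elim (λ q → c q ≡ true) f g f≤c g≤c
  join-least k (A ⇒ B) f≤c g≤c h h-InD = join-least k B (f≤c h h-InD) (g≤c h h-InD)

  join-mono : ∀ k A {f f' g g'} → Le k A f f' → Le k A g g' → Le k A (join A f g) (join A f' g')
  join-mono k A {f' = f'} {g' = g'} f≤f' g≤g' =
    join-least k A (Le-trans k A f≤f' (join-upperˡ k A f' g'))
                   (Le-trans k A g≤g' (join-upperʳ k A f' g'))

  Le-joinˡ : ∀ k A {f g c} → Le k A (join A f g) c → Le k A f c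
  Le-joinˡ k A {f} {g} = Le-trans k A (join-upperˡ k A f g)

  Le-joinʳ : ∀ k A {f g c} → Le k A (join A f g) c → Le k A g c
  Le-joinʳ k A {f} {g} = Le-trans k A (join-upperʳ k A f g)

  -- Pointwise emptiness on the whole ambient carrier, not only on 𝒟ᵏ.
  IsBot : (A : Ty) → Sem A → Set
  IsBot o       f = ∀ q → f q ≡ false
  IsBot (A ⇒ B) f = ∀ x → IsBot B (f x)

  bot-IsBot : ∀ A → IsBot A (bot A)
  bot-IsBot o       q = refl
  bot-IsBot (A ⇒ B) x = bot-IsBot B

  IsBot⇒≢true : ∀ {f} → IsBot o f → ∀ q → f q ≢ true
  IsBot⇒≢true f-bot q fq with trans (sym (f-bot q)) fq
  ... | ()

  IsBot⇒Le : ∀ k A {f} g → IsBot A f → Le k A f g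
  IsBot⇒Le k o       g f-bot q fq = ⊥-elim (IsBot⇒≢true f-bot q fq)
  IsBot⇒Le k (A ⇒ B) g f-bot h _  = IsBot⇒Le k B (g h) (f-bot h)

  bot-least : ∀ k A g → Le k A (bot A) g
  bot-least k A g = IsBot⇒Le k A g (bot-IsBot A)

  InD⇒Mono : ∀ k A B f → InD k (A ⇒ B) f → Mono k A B f
  InD⇒Mono zero    A B f f-InD                = f-InD
  InD⇒Mono (suc k) A B f (_ , _ , f-Mono , _) = f-Mono

  IsBot⇒Mono : ∀ k A B f → (∀ h → IsBot B (f h)) → (∀ h → InD k B (f h)) → Mono k A B f
  IsBot⇒Mono k A B f f-bot f-InD = (λ h _ → f-InD h) , λ h h' _ _ _ → IsBot⇒Le k B (f h') (f-bot h)

  mutual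
    IsBot⇒InD : ∀ k A f → IsBot A f → InD k A f
    IsBot⇒InD zero    o       f f-bot q fq = ⊥-elim (IsBot⇒≢true f-bot q fq)
    IsBot⇒InD (suc k) o       f f-bot q fq = ⊥-elim (IsBot⇒≢true f-bot q fq)
    IsBot⇒InD zero    (A ⇒ B) f f-bot =
      IsBot⇒Mono zero A B f f-bot (λ h → IsBot⇒InD zero B (f h) (f-bot h))
    IsBot⇒InD (suc k) (A ⇒ B) f f-bot = f , IsBot⇒𝓛 k (A ⇒ B) f f f-bot f-bot

    IsBot⇒𝓛 : ∀ k A f₁ f₂ → IsBot A f₁ → IsBot A f₂ → 𝓛 k A f₁ f₂
    IsBot⇒𝓛 k o       f₁ f₂ f₁-bot f₂-bot =
      (λ q f₂q → ⊥-elim (IsBot⇒≢true f₂-bot q f₂q)) ,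
      λ q → trans (f₁-bot q) (sym (cong (_∧ (ρ q ≤ᵇ k)) (f₂-bot q)))
    IsBot⇒𝓛 k (A ⇒ B) f₁ f₂ f₁-bot f₂-bot =
      IsBot⇒InD k (A ⇒ B) f₁ f₁-bot ,
      IsBot⇒Mono (suc k) A B f₂ f₂-bot (λ h → IsBot⇒InD (suc k) B (f₂ h) (f₂-bot h)) ,
      λ g₁ g₂ _ → IsBot⇒𝓛 k B (f₁ g₁) (f₂ g₂) (f₁-bot g₁) (f₂-bot g₂)

  InD-bot : ∀ k A → InD k A (bot A)
  InD-bot k A = IsBot⇒InD k A (bot A) (bot-IsBot A)

  mutual
    InD-join : ∀ k A f g → InD k A f → InD k A g → InD k A (join A f g)
    InD-join zero    o       f g = join-o-elim _ f g
    InD-join (suc k) o       f g = join-o-elim _ f g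
    InD-join zero    (A ⇒ B) f g = Mono-join zero A B f g
    InD-join (suc k) (A ⇒ B) f g (f₁ , f-𝓛) (g₁ , g-𝓛) =
      join (A ⇒ B) f₁ g₁ , 𝓛-join k (A ⇒ B) f₁ f g₁ g f-𝓛 g-𝓛

    Mono-join : ∀ k A B f g → Mono k A B f → Mono k A B g → Mono k A B (join (A ⇒ B) f g)
    Mono-join k A B f g (f-InD , f-mono) (g-InD , g-mono) =
      (λ h h-InD → InD-join k B (f h) (g h) (f-InD h h-InD) (g-InD h h-InD)) ,
      (λ h h' h-InD h'-InD h≤h' →
         join-mono k B (f-mono h h' h-InD h'-InD h≤h') (g-mono h h' h-InD h'-InD h≤h'))

    𝓛-join : ∀ k A f₁ f₂ g₁ g₂ → 𝓛 k A f₁ f₂ → 𝓛 k A g₁ g₂ → 𝓛 k A (join A f₁ g₁) (join A f₂ g₂)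
    𝓛-join k o f₁ f₂ g₁ g₂ (f₂-InD , f₁≡) (g₂-InD , g₁≡) =
      InD-join (suc k) o f₂ g₂ f₂-InD g₂-InD ,
      λ q → trans (cong₂ _∨_ (f₁≡ q) (g₁≡ q)) (sym (∧-distribʳ-∨ (ρ q ≤ᵇ k) (f₂ q) (g₂ q)))
    𝓛-join k (A ⇒ B) f₁ f₂ g₁ g₂ (f₁-InD , f₂-Mono , f-𝓛) (g₁-InD , g₂-Mono , g-𝓛) =
      InD-join k (A ⇒ B) f₁ g₁ f₁-InD g₁-InD ,
      Mono-join (suc k) A B f₂ g₂ f₂-Mono g₂-Mono ,
      λ h₁ h₂ h-𝓛 → 𝓛-join k B (f₁ h₁) (f₂ h₂) (g₁ h₁) (g₂ h₂) (f-𝓛 h₁ h₂ h-𝓛) (g-𝓛 h₁ h₂ h-𝓛)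

  𝓛-o-Le-restrict : ∀ k {f₁ f₂ g₁ g₂} → 𝓛 k o f₁ f₂ → 𝓛 k o g₁ g₂ → Le (suc k) o f₂ g₂ → Le k o f₁ g₁
  𝓛-o-Le-restrict k {f₂ = f₂} (_ , f₁≡) (_ , g₁≡) f₂≤g₂ q f₁q
    with ∧≡true⇒× (f₂ q) _ (trans (sym (f₁≡ q)) f₁q)
  ... | f₂q , ρq≤k = trans (g₁≡ q) (cong₂ _∧_ (f₂≤g₂ q f₂q) ρq≤k)

  Typed : (A : Ty) → ITy A → Set
  Typed A t = ∃ λ l → τ l A t

  𝒯⇒Typed : ∀ {k A t} → 𝒯 k A t → Typed A t
  𝒯⇒Typed (l , _ , t-τ) = l , t-τ

  𝒯-mono : ∀ {l k A t} → l ≤ k → 𝒯 l A t → 𝒯 k A t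
  𝒯-mono l≤k (l' , l'≤l , t-τ) = l' , ≤-trans l'≤l l≤k , t-τ

  dom : ∀ {A B} → ITy (A ⇒ B) → List (ITy A)
  dom (T ↦ _) = T

  cod : ∀ {A B} → ITy (A ⇒ B) → ITy B
  cod (_ ↦ t) = t

  dom-𝒯 : ∀ {k A B} {t : ITy (A ⇒ B)} → 𝒯 k (A ⇒ B) t → All (𝒯 k A) (dom t)
  dom-𝒯 {t = _ ↦ _} (_ , l≤k , T-𝒯 , _) = All.map (𝒯-mono l≤k) T-𝒯

  cod-𝒯 : ∀ {k A B} {t : ITy (A ⇒ B)} → 𝒯 k (A ⇒ B) t → 𝒯 k B (cod t)
  cod-𝒯 {t = _ ↦ _} (l , l≤k , _ , t-τ) = l , l≤k , t-τ

  ↦-⊑ : ∀ {A B} {S : List (ITy A)} {s : ITy B} t → dom t ⊑ˢ S → s ⊑ cod t → (S ↦ s) ⊑ t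
  ↦-⊑ (_ ↦ _) T⊑S s⊑t = T⊑S , s⊑t

  ≡⇒⊑-o : ∀ {s t : ITy o} → s ≡ t → s ⊑ t
  ≡⇒⊑-o {atom _} refl = refl

  ⊑ˢ⇒All-Any : ∀ {A} {S T : List (ITy A)} → S ⊑ˢ T → All (λ s → Any (s ⊑_) T) S
  ⊑ˢ⇒All-Any {o}     S⊆T = All.tabulate λ s∈S → Any.map ≡⇒⊑-o (S⊆T s∈S)
  ⊑ˢ⇒All-Any {_ ⇒ _} S⊑T = S⊑T

  module _ (em : ExcludedMiddle 0ℓ) where
    open Interp em

    step-elim : ∀ j A B d e h (P : Sem B → Set) → (Le j A d h → P e) → (¬ Le j A d h → P (bot B)) →
                P (step j A B d e h)
    step-elim j A B d e h P d≤h⇒P d≰h⇒P = elim (em {Le j A d h})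
      where
        elim : (d≤h? : Dec (Le j A d h)) → P (if does d≤h? then e else bot B)
        elim (yes d≤h) = d≤h⇒P d≤h
        elim (no d≰h)  = d≰h⇒P d≰h

    step-≥ : ∀ j A B d e h → Le j A d h → Le j B e (step j A B d e h)
    step-≥ j A B d e h d≤h =
      step-elim j A B d e h (Le j B e) (λ _ → Le-refl j B e) (λ d≰h → ⊥-elim (d≰h d≤h))

    step-Mono : ∀ j A B d e → InD j B e → Mono j A B (step j A B d e)
    step-Mono j A B d e e-InD =
      (λ h _ → step-elim j A B d e h (InD j B) (λ _ → e-InD) (λ _ → InD-bot j B)) ,
      (λ h h' _ _ h≤h' → step-elim j A B d e h (λ x → Le j B x (step j A B d e h'))
         (λ d≤h → step-≥ j A B d e h' (Le-trans j A d≤h h≤h'))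
         (λ _ → bot-least j B _))

    step-𝓛 : ∀ k A B {d₁ d₂ e₁ e₂ g₁ g₂} → 𝓛 k B e₁ e₂ →
             (Le (suc k) A d₂ g₂ → Le k A d₁ g₁) →
             (Le k A d₁ g₁ → ¬ Le (suc k) A d₂ g₂ → IsBot B e₁) →
             𝓛 k B (step k A B d₁ e₁ g₁) (step (suc k) A B d₂ e₂ g₂)
    step-𝓛 k A B {d₁} {d₂} {e₁} {e₂} {g₁} {g₂} e-𝓛 restrict vanish =
      step-elim k A B d₁ e₁ g₁ (λ x → 𝓛 k B x (step (suc k) A B d₂ e₂ g₂))
        (λ d₁≤g₁ → step-elim (suc k) A B d₂ e₂ g₂ (𝓛 k B e₁)
           (λ _ → e-𝓛)
           (λ d₂≰g₂ → IsBot⇒𝓛 k B e₁ (bot B) (vanish d₁≤g₁ d₂≰g₂) (bot-IsBot B)))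
        (λ d₁≰g₁ → step-elim (suc k) A B d₂ e₂ g₂ (𝓛 k B (bot B))
           (λ d₂≤g₂ → ⊥-elim (d₁≰g₁ (restrict d₂≤g₂)))
           (λ _ → IsBot⇒𝓛 k B (bot B) (bot B) (bot-IsBot B) (bot-IsBot B)))

    ⟦atom⟧≡true⇒ : ∀ j q p → ⟦ atom q ⟧ j p ≡ true → p ≡ q × ρ q ≤ j
    ⟦atom⟧≡true⇒ j q p e with ∧≡true⇒× (ρ q ≤ᵇ j) (does (p ≟ q)) e
    ... | ρq≤j , p≟q = ≟≡true⇒≡ p q p≟q , ≤ᵇ≡true⇒≤ (ρ q) j ρq≤j

    ⟦atom⟧-self : ∀ j q → ρ q ≤ j → ⟦ atom q ⟧ j q ≡ true
    ⟦atom⟧-self j q ρq≤j = cong₂ _∧_ (≤⇒≤ᵇ≡true ρq≤j) (dec-true (q ≟ q) refl)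

    ⟦atom⟧-InD : ∀ j q → InD j o (⟦ atom q ⟧ j)
    ⟦atom⟧-InD zero q p e with ⟦atom⟧≡true⇒ zero q p e
    ... | refl , ρq≤0 = n≤0⇒n≡0 ρq≤0
    ⟦atom⟧-InD (suc j) q p e with ⟦atom⟧≡true⇒ (suc j) q p e
    ... | refl , ρq≤j = ρq≤j

    ⟦atom⟧-restrict : ∀ k q p → ⟦ atom q ⟧ k p ≡ ⟦ atom q ⟧ (suc k) p ∧ (ρ p ≤ᵇ k)
    ⟦atom⟧-restrict k q p with p ≟ q
    ... | no _ = trans (∧-zeroʳ (ρ q ≤ᵇ k)) (sym (cong (_∧ (ρ p ≤ᵇ k)) (∧-zeroʳ (ρ q ≤ᵇ suc k))))
    ... | yes refl with ρ p ≤ᵇ k in ρp≤k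
    ...   | true  = sym (cong (λ b → (b ∧ true) ∧ true)
                          (≤⇒≤ᵇ≡true (m≤n⇒m≤1+n (≤ᵇ≡true⇒≤ (ρ p) k ρp≤k))))
    ...   | false = sym (∧-zeroʳ _)

    ⟦⟧-IsBot-below : ∀ k l A t → τ l A t → k < l → IsBot A (⟦ t ⟧ k)
    ⟦⟧-IsBot-below k l o (atom q) ρq≡l k<l p with ρ q ≤ᵇ k in ρq≤k
    ... | true  = ⊥-elim (<⇒≱ k<l (subst (_≤ k) ρq≡l (≤ᵇ≡true⇒≤ (ρ q) k ρq≤k)))
    ... | false = refl
    ⟦⟧-IsBot-below k l (A ⇒ B) (T ↦ s) (_ , s-τ) k<l h =
      step-elim k A B (⟦ T ⟧ˢ k) (⟦ s ⟧ k) h (IsBot B)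
        (λ _ → ⟦⟧-IsBot-below k l B s s-τ k<l) (λ _ → bot-IsBot B)

    ⟦⟧ˢ-upper : ∀ k A {t T} → t ∈ T → Le k A (⟦ t ⟧ k) (⟦ T ⟧ˢ k)
    ⟦⟧ˢ-upper k A (here refl) = join-upperˡ k A _ _
    ⟦⟧ˢ-upper k A (there t∈T) = Le-trans k A (⟦⟧ˢ-upper k A t∈T) (join-upperʳ k A _ _)

    ⟦⟧ˢ-least : ∀ k A {T c} → (∀ {t} → t ∈ T → Le k A (⟦ t ⟧ k) c) → Le k A (⟦ T ⟧ˢ k) c
    ⟦⟧ˢ-least k A {[]}    {c} _    = bot-least k A c
    ⟦⟧ˢ-least k A {t ∷ T} {c} each =
      join-least k A (each (here refl)) (⟦⟧ˢ-least k A (λ t∈T → each (there t∈T)))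

    mutual
      ⟦⟧-InD : ∀ j A t → Typed A t → InD j A (⟦ t ⟧ j)
      ⟦⟧-InD j       o       (atom q) _              = ⟦atom⟧-InD j q
      ⟦⟧-InD zero    (A ⇒ B) (T ↦ s) (l , _ , s-τ) =
        step-Mono zero A B (⟦ T ⟧ˢ zero) (⟦ s ⟧ zero) (⟦⟧-InD zero B s (l , s-τ))
      ⟦⟧-InD (suc k) (A ⇒ B) t       t-ty          = ⟦ t ⟧ k , ⟦⟧-𝓛 k (A ⇒ B) t t-ty

      ⟦⟧ˢ-InD : ∀ j A T → All (Typed A) T → InD j A (⟦ T ⟧ˢ j)
      ⟦⟧ˢ-InD j A []      []            = InD-bot j A
      ⟦⟧ˢ-InD j A (t ∷ T) (t-ty ∷ T-ty) =
        InD-join j A _ _ (⟦⟧-InD j A t t-ty) (⟦⟧ˢ-InD j A T T-ty)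

      ⟦⟧-𝓛 : ∀ k A t → Typed A t → 𝓛 k A (⟦ t ⟧ k) (⟦ t ⟧ (suc k))
      ⟦⟧-𝓛 k o       (atom q) _                  = ⟦atom⟧-InD (suc k) q , ⟦atom⟧-restrict k q
      ⟦⟧-𝓛 k (A ⇒ B) (T ↦ s) t-ty@(l , T-𝒯 , s-τ) =
        ⟦⟧-InD k (A ⇒ B) (T ↦ s) t-ty ,
        step-Mono (suc k) A B _ _ (⟦⟧-InD (suc k) B s (l , s-τ)) ,
        λ _ _ g-𝓛 → step-𝓛 k A B (⟦⟧-𝓛 k B s (l , s-τ)) (⟦⟧ˢ-Le-down k A T T-ty g-𝓛) (vanish g-𝓛)
        where
          T-ty : All (Typed A) T
          T-ty = All.map 𝒯⇒Typed T-𝒯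

          -- T can be enabled at level k but not at k+1 only if l > k, and then
          -- ⟦s⟧ᵏ is empty.
          vanish : ∀ {g₁ g₂} → 𝓛 k A g₁ g₂ → Le k A (⟦ T ⟧ˢ k) g₁ →
                   ¬ Le (suc k) A (⟦ T ⟧ˢ (suc k)) g₂ → IsBot B (⟦ s ⟧ k)
          vanish g-𝓛 T≤g₁ T≰g₂ with l ≤? k
          ... | yes l≤k = ⊥-elim (T≰g₂ (⟦⟧ˢ-Le-up k A T (All.map (𝒯-mono l≤k) T-𝒯) g-𝓛 T≤g₁))
          ... | no  l≰k = ⟦⟧-IsBot-below k l B s s-τ (≰⇒> l≰k)

      ⟦⟧ˢ-𝓛 : ∀ k A T → All (Typed A) T → 𝓛 k A (⟦ T ⟧ˢ k) (⟦ T ⟧ˢ (suc k))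
      ⟦⟧ˢ-𝓛 k A []      []            = IsBot⇒𝓛 k A _ _ (bot-IsBot A) (bot-IsBot A)
      ⟦⟧ˢ-𝓛 k A (t ∷ T) (t-ty ∷ T-ty) = 𝓛-join k A _ _ _ _ (⟦⟧-𝓛 k A t t-ty) (⟦⟧ˢ-𝓛 k A T T-ty)

      ⟦⟧-Le-down : ∀ k A t → Typed A t → ∀ {b₁ b₂} → 𝓛 k A b₁ b₂ →
                   Le (suc k) A (⟦ t ⟧ (suc k)) b₂ → Le k A (⟦ t ⟧ k) b₁
      ⟦⟧-Le-down k o t t-ty b-𝓛 = 𝓛-o-Le-restrict k (⟦⟧-𝓛 k o t t-ty) b-𝓛
      ⟦⟧-Le-down k (A ⇒ B) (T ↦ s) (l , T-𝒯 , s-τ) {b₁} {b₂} (b₁-InD , _ , b-app) t≤b₂ h h-InD =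
        step-elim k A B (⟦ T ⟧ˢ k) (⟦ s ⟧ k) h (λ x → Le k B x (b₁ h))
          (λ T≤h → Le-trans k B s≤b₁T
                     (proj₂ (InD⇒Mono k A B b₁ b₁-InD) _ h (⟦⟧ˢ-InD k A T T-ty) h-InD T≤h))
          (λ _ → bot-least k B (b₁ h))
        where
          T-ty : All (Typed A) T
          T-ty = All.map 𝒯⇒Typed T-𝒯

          s≤b₂T : Le (suc k) B (⟦ s ⟧ (suc k)) (b₂ (⟦ T ⟧ˢ (suc k)))
          s≤b₂T = Le-trans (suc k) B
            (step-≥ (suc k) A B (⟦ T ⟧ˢ (suc k)) (⟦ s ⟧ (suc k)) _ (Le-refl (suc k) A _))
            (t≤b₂ _ (⟦⟧ˢ-InD (suc k) A T T-ty))

          s≤b₁T : Le k B (⟦ s ⟧ k) (b₁ (⟦ T ⟧ˢ k))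
          s≤b₁T = ⟦⟧-Le-down k B s (l , s-τ) (b-app _ _ (⟦⟧ˢ-𝓛 k A T T-ty)) s≤b₂T

      ⟦⟧ˢ-Le-down : ∀ k A T → All (Typed A) T → ∀ {b₁ b₂} → 𝓛 k A b₁ b₂ →
                    Le (suc k) A (⟦ T ⟧ˢ (suc k)) b₂ → Le k A (⟦ T ⟧ˢ k) b₁
      ⟦⟧ˢ-Le-down k A []      []            {b₁} _ _ = bot-least k A b₁
      ⟦⟧ˢ-Le-down k A (t ∷ T) (t-ty ∷ T-ty) b-𝓛 T≤b₂ =
        join-least k A (⟦⟧-Le-down k A t t-ty b-𝓛 (Le-joinˡ (suc k) A T≤b₂))
                       (⟦⟧ˢ-Le-down k A T T-ty b-𝓛 (Le-joinʳ (suc k) A T≤b₂))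

      ⟦⟧-Le-up : ∀ k A t → 𝒯 k A t → ∀ {b₁ b₂} → 𝓛 k A b₁ b₂ →
                 Le k A (⟦ t ⟧ k) b₁ → Le (suc k) A (⟦ t ⟧ (suc k)) b₂
      ⟦⟧-Le-up k o (atom q) (l , l≤k , ρq≡l) {b₁} {b₂} (_ , b₁≡) t≤b₁ p e
        with ⟦atom⟧≡true⇒ (suc k) q p e
      ... | refl , _ = proj₁ (∧≡true⇒× (b₂ p) _ (trans (sym (b₁≡ p)) (t≤b₁ p atom-self)))
        where
          atom-self : ⟦ atom p ⟧ k p ≡ true
          atom-self = ⟦atom⟧-self k p (subst (_≤ k) (sym ρq≡l) l≤k)
      ⟦⟧-Le-up k (A ⇒ B) (T ↦ s) (l , l≤k , T-𝒯 , s-τ) {b₁} {b₂} (_ , (_ , b₂-mono) , b-app)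
               t≤b₁ h h-InD =
        step-elim (suc k) A B (⟦ T ⟧ˢ (suc k)) (⟦ s ⟧ (suc k)) h (λ x → Le (suc k) B x (b₂ h))
          (λ T≤h → Le-trans (suc k) B s≤b₂T (b₂-mono _ h (⟦⟧ˢ-InD (suc k) A T T-ty) h-InD T≤h))
          (λ _ → bot-least (suc k) B (b₂ h))
        where
          T-ty : All (Typed A) T
          T-ty = All.map 𝒯⇒Typed T-𝒯

          s≤b₁T : Le k B (⟦ s ⟧ k) (b₁ (⟦ T ⟧ˢ k))
          s≤b₁T = Le-trans k B
            (step-≥ k A B (⟦ T ⟧ˢ k) (⟦ s ⟧ k) _ (Le-refl k A _))
            (t≤b₁ _ (⟦⟧ˢ-InD k A T T-ty))

          s≤b₂T : Le (suc k) B (⟦ s ⟧ (suc k)) (b₂ (⟦ T ⟧ˢ (suc k)))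
          s≤b₂T = ⟦⟧-Le-up k B s (l , l≤k , s-τ) (b-app _ _ (⟦⟧ˢ-𝓛 k A T T-ty)) s≤b₁T

      ⟦⟧ˢ-Le-up : ∀ k A T → All (𝒯 k A) T → ∀ {b₁ b₂} → 𝓛 k A b₁ b₂ →
                  Le k A (⟦ T ⟧ˢ k) b₁ → Le (suc k) A (⟦ T ⟧ˢ (suc k)) b₂
      ⟦⟧ˢ-Le-up k A []      []            {b₂ = b₂} _ _ = bot-least (suc k) A b₂
      ⟦⟧ˢ-Le-up k A (t ∷ T) (t-𝒯 ∷ T-𝒯) b-𝓛 T≤b₁ =
        join-least (suc k) A (⟦⟧-Le-up k A t t-𝒯 b-𝓛 (Le-joinˡ k A T≤b₁))
                             (⟦⟧ˢ-Le-up k A T T-𝒯 b-𝓛 (Le-joinʳ k A T≤b₁))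

    mutual
      ⊑⇒Le : ∀ k {A} {s t : ITy A} → s ⊑ t → Le k A (⟦ s ⟧ k) (⟦ t ⟧ k)
      ⊑⇒Le k {o}     {atom _} {atom _} refl = Le-refl k o _
      ⊑⇒Le k {A ⇒ B} {S ↦ s}  {T ↦ t}  (T⊑S , s⊑t) h _ =
        step-elim k A B (⟦ S ⟧ˢ k) (⟦ s ⟧ k) h (λ x → Le k B x (⟦ T ↦ t ⟧ k h))
          (λ S≤h → Le-trans k B (⊑⇒Le k s⊑t)
                     (step-≥ k A B (⟦ T ⟧ˢ k) (⟦ t ⟧ k) h (Le-trans k A (⊑ˢ⇒Le k T⊑S) S≤h)))
          (λ _ → bot-least k B _)

      ⊑ˢ⇒Le : ∀ k {A} {S T : List (ITy A)} → S ⊑ˢ T → Le k A (⟦ S ⟧ˢ k) (⟦ T ⟧ˢ k)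
      ⊑ˢ⇒Le k {A} S⊑T = ⟦⟧ˢ-least k A λ s∈S →
        let t , t∈T , s⊑t = find (All.lookup (⊑ˢ⇒All-Any S⊑T) s∈S)
        in Le-trans k A (⊑⇒Le k s⊑t) (⟦⟧ˢ-upper k A t∈T)

    enabled? : ∀ k {A B} (h : Sem A) → Decidable (λ (t : ITy (A ⇒ B)) → Le k A (⟦ dom t ⟧ˢ k) h)
    enabled? k h t = em

    ⟦⟧ˢ-apply-Le : ∀ k A B (T : List (ITy (A ⇒ B))) h →
                   Le k B (⟦ T ⟧ˢ k h) (⟦ map cod (filter (enabled? k h) T) ⟧ˢ k)
    ⟦⟧ˢ-apply-Le k A B []             h = Le-refl k B (bot B)
    ⟦⟧ˢ-apply-Le k A B ((T' ↦ t') ∷ T) h with em {Le k A (⟦ T' ⟧ˢ k) h}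
    ... | yes _ = join-mono k B (Le-refl k B _) (⟦⟧ˢ-apply-Le k A B T h)
    ... | no  _ = join-least k B (bot-least k B _) (⟦⟧ˢ-apply-Le k A B T h)

    atom∈ : ∀ k q T → ⟦ T ⟧ˢ k q ≡ true → atom q ∈ T
    atom∈ k q []           ()
    atom∈ k q (atom r ∷ T) e with ∨≡true⇒⊎ (⟦ atom r ⟧ k q) (⟦ T ⟧ˢ k q) e
    ... | inj₁ r-q = here (cong atom (proj₁ (⟦atom⟧≡true⇒ k r q r-q)))
    ... | inj₂ T-q = there (atom∈ k q T T-q)

    mutual
      Le⇒⊑ˢ : ∀ k A S T → All (𝒯 k A) S → All (𝒯 k A) T → Le k A (⟦ S ⟧ˢ k) (⟦ T ⟧ˢ k) → S ⊑ˢ T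
      Le⇒⊑ˢ k o S T S-𝒯 _ S≤T {atom q} q∈S with All.lookup S-𝒯 q∈S
      ... | l , l≤k , ρq≡l =
        atom∈ k q T (S≤T q (⟦⟧ˢ-upper k o q∈S q (⟦atom⟧-self k q (subst (_≤ k) (sym ρq≡l) l≤k))))
      Le⇒⊑ˢ k (A ⇒ B) S T S-𝒯 T-𝒯 S≤T = All.tabulate λ s∈S →
        Le⇒Any⊑ k A B _ T (All.lookup S-𝒯 s∈S) T-𝒯
          (Le-trans k (A ⇒ B) (⟦⟧ˢ-upper k (A ⇒ B) s∈S) S≤T)

      Le⇒Any⊑ : ∀ k A B s T → 𝒯 k (A ⇒ B) s → All (𝒯 k (A ⇒ B)) T →
                Le k (A ⇒ B) (⟦ s ⟧ k) (⟦ T ⟧ˢ k) → Any (s ⊑_) T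
      Le⇒Any⊑ k A B (S ↦ s) T (l , l≤k , S-𝒯 , s-τ) T-𝒯 s≤T =
        let t , t∈U , s⊑t = find (map⁻ (All.head (⊑ˢ⇒All-Any s⊑U)))
            t∈T , t-enabled = ∈-filter⁻ (enabled? k h) t∈U
        in lose t∈T (↦-⊑ t (Le⇒⊑ˢ k A (dom t) S (dom-𝒯 (All.lookup T-𝒯 t∈T)) S-𝒯ₖ t-enabled) s⊑t)
        where
          h : Sem A
          h = ⟦ S ⟧ˢ k

          U : List (ITy (A ⇒ B))
          U = filter (enabled? k h) T

          S-𝒯ₖ : All (𝒯 k A) S
          S-𝒯ₖ = All.map (𝒯-mono l≤k) S-𝒯

          s≤U : Le k B (⟦ s ⟧ k) (⟦ map cod U ⟧ˢ k)
          s≤U = Le-trans k B (step-≥ k A B h (⟦ s ⟧ k) h (Le-refl k A h))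
                  (Le-trans k B (s≤T h (⟦⟧ˢ-InD k A S (All.map 𝒯⇒Typed S-𝒯)))
                                (⟦⟧ˢ-apply-Le k A B T h))

          s⊑U : (s ∷ []) ⊑ˢ map cod U
          s⊑U = Le⇒⊑ˢ k B (s ∷ []) (map cod U) ((l , l≤k , s-τ) ∷ [])
                  (map⁺ (All.map cod-𝒯 (filter⁺ (enabled? k h) T-𝒯)))
                  (join-least k B s≤U (bot-least k B _))

lemma5p3 : (n : ℕ) (ρ : Fin n → ℕ) (em : ExcludedMiddle 0ℓ) (m : ℕ)
    → (∀ q → ρ q ≤ m) → ∃ (λ q → ρ q ≡ m)
    → (k : ℕ) → k ≤ m → (A : Ty)
    → (S T : List (Model.ITy n ρ A))
    → All (Model.𝒯 n ρ k A) S → All (Model.𝒯 n ρ k A) T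
    → (Model.Le n ρ k A (Model.Interp.⟦_⟧ˢ n ρ em S k) (Model.Interp.⟦_⟧ˢ n ρ em T k)
       ⇔ Model._⊑ˢ_ n ρ S T)
lemma5p3 n ρ em _ _ _ k _ A S T S-𝒯 T-𝒯 =
  mk⇔ (Le⇒⊑ˢ n ρ em k A S T S-𝒯 T-𝒯) (⊑ˢ⇒Le n ρ em k)
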